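{- For every integer $n\ge 9$: (a) $S(C_n,k)>S(C_n,k-1)$ for all $k\in\{3,4,5\}$; (b) $S(C_n,k)>3S(C_{n-1},k-1)$ for all $k\in\{3,4,5,6\}$; (c) $S(C_n,4)>8S(C_n,3)$.
   Context: For a finite simple graph $H$ and an integer $k$, $S(H,k)$ denotes the number of partitions of $V(H)$ into exactly $k$ nonempty stable sets. $C_m$ is the cycle on $m$ vertices. -}

module Defs where

open import Data.Bool using (Bool; true; false; _∧_; _∨_; not; if_then_else_)
open import Data.Nat using (ℕ; zero; suc; _≡ᵇ_; _<ᵇ_; _%_)
open import Data.Fin using (Fin; toℕ)
open import Data.List using (List; []; _∷_; allFin; filter; length; concatMap; map)
open import Data.Bool.ListAction using (all; any)
open import Data.Vec using (Vec; []; _∷_; lookup)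
open import Relation.Nullary.Decidable using (does)
open import Relation.Binary.PropositionalEquality using (_≡_)

record Graph : Set where
  field
    size : ℕ
    adj  : Fin size → Fin size → Bool
open Graph public

-- Cycle C_m on vertices 0..m-1 : i ~ j iff j ≡ i+1 (mod m) or i ≡ j+1 (mod m).
-- (A genuine simple cycle for m ≥ 3, which is all that is used.)
cycle : ℕ → Graph
cycle zero    = record { size = zero ; adj = λ _ _ → false }
cycle (suc m) = record
  { size = suc m
  ; adj  = λ i j → ((toℕ j ≡ᵇ (suc (toℕ i) % suc m))
                   ∨ (toℕ i ≡ᵇ (suc (toℕ j) % suc m)))
  }

allVecs : ∀ n k → List (Vec (Fin k) n)
allVecs zero    k = [] ∷ []
allVecs (suc n) k = concatMap (λ c → map (c ∷_) (allVecs n k)) (allFin k)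

_=ᶠ_ : ∀ {k} → Fin k → Fin k → Bool
a =ᶠ b = toℕ a ≡ᵇ toℕ b

-- A partition of V(H) into exactly k nonempty blocks is encoded by its
-- unique canonical labelling f : V(H) → Fin k in which the blocks are numbered
-- 0..k-1 in increasing order of their least vertex:
--   * surjective  : every label is used (k nonempty blocks);
--   * canonical   : whenever f i = c, every label c' < c occurs at some j < i.
module _ (H : Graph) (k : ℕ) where
  private
    V = Fin (size H)

  stableB : Vec (Fin k) (size H) → Bool
  stableB f = all (λ i → all (λ j → not (adj H i j) ∨ not (lookup f i =ᶠ lookup f j))
                             (allFin (size H)))
                  (allFin (size H))

  surjB : Vec (Fin k) (size H) → Bool
  surjB f = all (λ c → any (λ i → lookup f i =ᶠ c) (allFin (size H))) (allFin k)

  canonB : Vec (Fin k) (size H) → Bool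
  canonB f = all (λ i → all (λ c → not (toℕ c <ᵇ toℕ (lookup f i))
                                   ∨ any (λ j → (toℕ j <ᵇ toℕ i) ∧ (lookup f j =ᶠ c))
                                         (allFin (size H)))
                            (allFin k))
                 (allFin (size H))

  isStablePartition : Vec (Fin k) (size H) → Bool
  isStablePartition f = stableB f ∧ surjB f ∧ canonB f

S : Graph → ℕ → ℕ
S H k = length (filter (λ f → isStablePartition H k f ≟b true) (allVecs (size H) k))
  where
  open import Data.Bool.Properties using () renaming (_≟_ to _≟b_)

{-# OPTIONS --safe #-}
-- A partition of V(C_N) into k stable sets is encoded by its canonical labelling: a restricted
-- growth string x₀ … x_{N-1} over {0, …, k-1} (so x₀ = 0) using all k letters, with no two
-- cyclically consecutive letters equal. Reading it with an automaton whose state is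
-- (letters used so far, last letter) and sorting the strings by their last letter gives
--   S(C_{N+1}, k) + S(C_N, k) = S(N, k-1)      (N ≥ 1),
-- a Stirling number of the second kind: both sides count the canonical stable labellings of
-- the path on N + 1 vertices, those ending in 0 being the cycle labellings of length N
-- followed by 0. With the explicit formula for S(N, j), j ≤ 5, this recurrence turns
-- k! S(C_N, k) into an exponential polynomial in N over the bases 5, 4, 3, 2, 1, -1, and each
-- inequality of the theorem into the positivity of such a polynomial for N ≥ 9. Its leading
-- term exceeds the sum of the absolute values of the other terms at some N₀, hence, all other
-- bases being smaller, at every N ≥ N₀; the few values below N₀ are evaluated directly.
module Submission where

open import Defs

module ExponentialPolynomials where

  open import Data.Bool.Base using (Bool; false; _∧_; T)
  open import Data.Bool.Properties using (T-∧)
  open import Data.Integer.Base using (ℤ; +_; -[1+_]; _+_; _-_; _*_; _^_; ∣_∣; _<_; 0ℤ; +<+)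
  open import Data.Integer.Properties
    using (_<?_; ∣i+j∣≤∣i∣+∣j∣; ∣i*j∣≡∣i∣*∣j∣; pos-*; +-identityˡ; ⊖-≥; *-zeroʳ)
  open import Data.Integer.Tactic.RingSolver using (solve-∀)
  open import Data.Nat.Base as ℕ using (ℕ; zero; suc; NonZero; _<ᵇ_)
  import Data.Nat.Properties as ℕ
  open import Algebra.Properties.CommutativeSemigroup ℕ.*-commutativeSemigroup
    using () renaming (x∙yz≈y∙xz to x*[y*z]≡y*[x*z])
  open import Data.Product.Base using (_×_; proj₁; proj₂)
  open import Data.Sum.Base using (inj₁; inj₂)
  open import Data.Vec.Base using (Vec; []; _∷_; map; zipWith)
  open import Data.Vec.Relation.Unary.All using (All; []; _∷_; all?)
  open import Function.Bundles using (Equivalence)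
  open import Relation.Binary.PropositionalEquality using (_≡_; refl; sym; trans; cong; subst)
  open import Relation.Nullary.Decidable using (isYes; toWitness)

  private variable
    m : ℕ

  eval : Vec ℤ m → Vec ℤ m → ℕ → ℤ
  eval []       []       n = 0ℤ
  eval (b ∷ bs) (c ∷ cs) n = c * b ^ n + eval bs cs n

  infixl 6 _⊕_ _⊝_
  infixr 7 _⊛_

  _⊕_ : Vec ℤ m → Vec ℤ m → Vec ℤ m
  _⊕_ = zipWith _+_

  _⊝_ : Vec ℤ m → Vec ℤ m → Vec ℤ m
  _⊝_ = zipWith _-_

  _⊛_ : ℤ → Vec ℤ m → Vec ℤ m
  a ⊛ cs = map (a *_) cs

  shift : Vec ℤ m → Vec ℤ m → Vec ℤ m
  shift bs cs = zipWith _*_ cs bs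

  eval-⊕ : ∀ (bs us vs : Vec ℤ m) n → eval bs (us ⊕ vs) n ≡ eval bs us n + eval bs vs n
  eval-⊕ []       []       []       n = refl
  eval-⊕ (b ∷ bs) (u ∷ us) (v ∷ vs) n rewrite eval-⊕ bs us vs n =
    regroup u v (b ^ n) (eval bs us n) (eval bs vs n)
    where
    regroup : ∀ u v x e f → (u + v) * x + (e + f) ≡ u * x + e + (v * x + f)
    regroup = solve-∀

  eval-⊝ : ∀ (bs us vs : Vec ℤ m) n → eval bs (us ⊝ vs) n ≡ eval bs us n - eval bs vs n
  eval-⊝ []       []       []       n = refl
  eval-⊝ (b ∷ bs) (u ∷ us) (v ∷ vs) n rewrite eval-⊝ bs us vs n =
    regroup u v (b ^ n) (eval bs us n) (eval bs vs n)
    where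
    regroup : ∀ u v x e f → (u - v) * x + (e - f) ≡ u * x + e - (v * x + f)
    regroup = solve-∀

  eval-⊛ : ∀ a (bs cs : Vec ℤ m) n → eval bs (a ⊛ cs) n ≡ a * eval bs cs n
  eval-⊛ a []       []       n = sym (*-zeroʳ a)
  eval-⊛ a (b ∷ bs) (c ∷ cs) n rewrite eval-⊛ a bs cs n = regroup a c (b ^ n) (eval bs cs n)
    where
    regroup : ∀ a c x e → a * c * x + a * e ≡ a * (c * x + e)
    regroup = solve-∀

  eval-shift : ∀ (bs cs : Vec ℤ m) n → eval bs (shift bs cs) n ≡ eval bs cs (suc n)
  eval-shift []       []       n = refl
  eval-shift (b ∷ bs) (c ∷ cs) n rewrite eval-shift bs cs n = regroup c b (b ^ n) (eval bs cs (suc n))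
    where
    regroup : ∀ c b x e → c * b * x + e ≡ c * (b * x) + e
    regroup = solve-∀

  magnitude : Vec ℤ m → Vec ℤ m → ℕ → ℕ
  magnitude []       []       n = 0
  magnitude (b ∷ bs) (c ∷ cs) n = ∣ c ∣ ℕ.* ∣ b ∣ ℕ.^ n ℕ.+ magnitude bs cs n

  ∣i^n∣≡∣i∣^n : ∀ i n → ∣ i ^ n ∣ ≡ ∣ i ∣ ℕ.^ n
  ∣i^n∣≡∣i∣^n i zero    = refl
  ∣i^n∣≡∣i∣^n i (suc n) = trans (∣i*j∣≡∣i∣*∣j∣ i (i ^ n)) (cong (∣ i ∣ ℕ.*_) (∣i^n∣≡∣i∣^n i n))

  pos-^ : ∀ d n → (+ d) ^ n ≡ + (d ℕ.^ n)
  pos-^ d zero    = refl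
  pos-^ d (suc n) = trans (cong ((+ d) *_) (pos-^ d n)) (sym (pos-* d (d ℕ.^ n)))

  ∣eval∣≤magnitude : ∀ (bs cs : Vec ℤ m) n → ∣ eval bs cs n ∣ ℕ.≤ magnitude bs cs n
  ∣eval∣≤magnitude []       []       n = ℕ.≤-refl
  ∣eval∣≤magnitude (b ∷ bs) (c ∷ cs) n = begin
    ∣ c * b ^ n + eval bs cs n ∣              ≤⟨ ∣i+j∣≤∣i∣+∣j∣ (c * b ^ n) (eval bs cs n) ⟩
    ∣ c * b ^ n ∣ ℕ.+ ∣ eval bs cs n ∣        ≡⟨ cong (ℕ._+ ∣ eval bs cs n ∣) ∣c*b^n∣ ⟩
    ∣ c ∣ ℕ.* ∣ b ∣ ℕ.^ n ℕ.+ ∣ eval bs cs n ∣ ≤⟨ ℕ.+-monoʳ-≤ _ (∣eval∣≤magnitude bs cs n) ⟩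
    magnitude (b ∷ bs) (c ∷ cs) n              ∎
    where
    open ℕ.≤-Reasoning
    ∣c*b^n∣ : ∣ c * b ^ n ∣ ≡ ∣ c ∣ ℕ.* ∣ b ∣ ℕ.^ n
    ∣c*b^n∣ = trans (∣i*j∣≡∣i∣*∣j∣ c (b ^ n)) (cong (∣ c ∣ ℕ.*_) (∣i^n∣≡∣i∣^n b n))

  magnitude-suc : ∀ {d} (bs cs : Vec ℤ m) n → All (λ b → ∣ b ∣ ℕ.≤ d) bs →
                  magnitude bs cs (suc n) ℕ.≤ d ℕ.* magnitude bs cs n
  magnitude-suc         []       []       n []           = ℕ.z≤n
  magnitude-suc {d = d} (b ∷ bs) (c ∷ cs) n (b≤d ∷ bs≤d) = begin
    ∣ c ∣ ℕ.* (∣ b ∣ ℕ.* ∣ b ∣ ℕ.^ n) ℕ.+ magnitude bs cs (suc n)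
      ≡⟨ cong (ℕ._+ magnitude bs cs (suc n)) (x*[y*z]≡y*[x*z] ∣ c ∣ ∣ b ∣ (∣ b ∣ ℕ.^ n)) ⟩
    ∣ b ∣ ℕ.* (∣ c ∣ ℕ.* ∣ b ∣ ℕ.^ n) ℕ.+ magnitude bs cs (suc n)
      ≤⟨ ℕ.+-mono-≤ (ℕ.*-monoˡ-≤ (∣ c ∣ ℕ.* ∣ b ∣ ℕ.^ n) b≤d) (magnitude-suc bs cs n bs≤d) ⟩
    d ℕ.* (∣ c ∣ ℕ.* ∣ b ∣ ℕ.^ n) ℕ.+ d ℕ.* magnitude bs cs n
      ≡⟨ ℕ.*-distribˡ-+ d (∣ c ∣ ℕ.* ∣ b ∣ ℕ.^ n) (magnitude bs cs n) ⟨
    d ℕ.* magnitude (b ∷ bs) (c ∷ cs) n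
      ∎
    where open ℕ.≤-Reasoning

  magnitude-dominated : ∀ a d (bs cs : Vec ℤ m) .{{_ : NonZero d}} →
    All (λ b → ∣ b ∣ ℕ.≤ d) bs →
    ∀ {M} → magnitude bs cs M ℕ.< a ℕ.* d ℕ.^ M →
    ∀ n → M ℕ.≤ n → magnitude bs cs n ℕ.< a ℕ.* d ℕ.^ n
  magnitude-dominated a d bs cs bounded dominated n M≤n with ℕ.m≤n⇒m<n∨m≡n M≤n
  ... | inj₂ refl = dominated
  magnitude-dominated a d bs cs bounded dominated (suc n) _ | inj₁ M<1+n = begin-strict
    magnitude bs cs (suc n)  ≤⟨ magnitude-suc bs cs n bounded ⟩
    d ℕ.* magnitude bs cs n  <⟨ ℕ.*-monoʳ-< d (magnitude-dominated a d bs cs bounded dominated n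
                                                                     (ℕ.s≤s⁻¹ M<1+n)) ⟩
    d ℕ.* (a ℕ.* d ℕ.^ n)    ≡⟨ x*[y*z]≡y*[x*z] d a (d ℕ.^ n) ⟩
    a ℕ.* (d ℕ.* d ℕ.^ n)    ∎
    where open ℕ.≤-Reasoning

  ∣j∣<i⇒0<+i+j : ∀ i j → ∣ j ∣ ℕ.< i → 0ℤ < + i + j
  ∣j∣<i⇒0<+i+j i (+ j)    j<i = +<+ (ℕ.<-≤-trans (ℕ.≤-<-trans ℕ.z≤n j<i) (ℕ.m≤m+n i j))
  ∣j∣<i⇒0<+i+j i -[1+ j ] j<i = subst (0ℤ <_) (sym (⊖-≥ (ℕ.<⇒≤ j<i))) (+<+ (ℕ.m<n⇒0<n∸m j<i))

  dominated? : Vec ℤ m → Vec ℤ m → ℕ → Bool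
  dominated? (b ∷ bs)       (+ zero ∷ cs)  M = dominated? bs cs M
  dominated? (+ suc d ∷ bs) (+ suc a ∷ cs) M =
    isYes (all? (λ b → ∣ b ∣ ℕ.≤? suc d) bs) ∧ (magnitude bs cs M <ᵇ suc a ℕ.* suc d ℕ.^ M)
  dominated? _ _ _ = false

  dominated-positive : ∀ (bs cs : Vec ℤ m) M {_ : T (dominated? bs cs M)} →
                       ∀ n → M ℕ.≤ n → 0ℤ < eval bs cs n
  dominated-positive (b ∷ bs) (+ zero ∷ cs) M {ok} n M≤n =
    subst (0ℤ <_) (sym (+-identityˡ (eval bs cs n))) (dominated-positive bs cs M {ok} n M≤n)
  dominated-positive (+ suc d ∷ bs) (+ suc a ∷ cs) M {ok} n M≤n =
    subst (λ t → 0ℤ < t + eval bs cs n) leading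
          (∣j∣<i⇒0<+i+j (suc a ℕ.* suc d ℕ.^ n) (eval bs cs n) small)
    where
    checks : T (isYes (all? (λ b → ∣ b ∣ ℕ.≤? suc d) bs))
           × T (magnitude bs cs M <ᵇ suc a ℕ.* suc d ℕ.^ M)
    checks = Equivalence.to T-∧ ok
    small : ∣ eval bs cs n ∣ ℕ.< suc a ℕ.* suc d ℕ.^ n
    small = ℕ.≤-<-trans (∣eval∣≤magnitude bs cs n)
              (magnitude-dominated (suc a) (suc d) bs cs (toWitness (proj₁ checks))
                                   (ℕ.<ᵇ⇒< _ _ (proj₂ checks)) n M≤n)
    leading : + (suc a ℕ.* suc d ℕ.^ n) ≡ + suc a * (+ suc d) ^ n
    leading = trans (pos-* (suc a) (suc d ℕ.^ n)) (cong (+ suc a *_) (sym (pos-^ (suc d) n)))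

  eventually-dominated? : Vec ℤ m → Vec ℤ m → ℕ → ℕ → Bool
  eventually-dominated? bs cs M zero    = dominated? bs cs M
  eventually-dominated? bs cs M (suc x) = isYes (0ℤ <? eval bs cs M) ∧ eventually-dominated? bs cs (suc M) x

  positive : ∀ (bs cs : Vec ℤ m) M x {_ : T (eventually-dominated? bs cs M x)} →
             ∀ n → M ℕ.≤ n → 0ℤ < eval bs cs n
  positive bs cs M zero    {ok} = dominated-positive bs cs M {ok}
  positive bs cs M (suc x) {ok} n M≤n with ℕ.m≤n⇒m<n∨m≡n M≤n
  ... | inj₂ refl = toWitness {a? = 0ℤ <? eval bs cs M} (proj₁ (Equivalence.to T-∧ ok))
  ... | inj₁ M<n  = positive bs cs (suc M) x {proj₂ (Equivalence.to T-∧ ok)} n M<n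

open ExponentialPolynomials

open import Data.Nat using (ℕ; _≤_; _<_; _*_; _∸_)
open import Data.Product using (_×_)

open import Data.Bool.Base using (Bool; true; false; _∧_; _∨_; not; if_then_else_; T)
open import Data.Bool.Properties using (T-∧; T-∨; ∧-comm; ∧-zeroʳ) renaming (_≟_ to _≟ᵇ_)
open import Data.Bool.ListAction using (all; any)
open import Data.Empty using (⊥-elim)
open import Data.Fin.Base using (Fin; zero; suc; toℕ; fromℕ; fromℕ<)
open import Data.Fin.Properties using (toℕ-injective; toℕ-fromℕ; toℕ<n; toℕ-fromℕ<)
import Data.Integer.Base as ℤ
import Data.Integer.Properties as ℤ
import Data.Integer.Tactic.RingSolver as ℤ-Solver
open import Data.List.Base using (List; []; _∷_; _++_; map; concatMap; allFin; filter; length)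
open import Data.List.Properties using (map-tabulate)
import Data.List.Relation.Unary.All.Properties as All
import Data.List.Relation.Unary.Any.Properties as Any
open import Data.Maybe.Base using (Maybe; just; nothing; _>>=_)
open import Data.Nat.Base
  using (zero; suc; _+_; _!; _≡ᵇ_; _<ᵇ_; _%_; _≮_; z≤n; s≤s; z<s; s<s; s≤s⁻¹; s<s⁻¹)
import Data.Nat.Properties as ℕ
open import Data.Nat.Properties
  using ( ≡ᵇ⇒≡; ≡⇒≡ᵇ; <ᵇ⇒<; <⇒<ᵇ; <-trans; <-irrefl; <-≤-trans; ≤-refl; n<1+n
        ; m≤n⇒m<n∨m≡n; ≮⇒≥; <⇒≢; suc-injective; +-assoc; +-comm; +-identityʳ; +-cancelʳ-≡
        ; *-zeroʳ; *-identityˡ; *-identityʳ; *-comm; *-assoc; *-distribˡ-+; *-cancelˡ-<; _≤?_)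
open import Data.Nat.DivMod using (m<n⇒m%n≡m; n%n≡0)
import Data.Nat.Tactic.RingSolver as ℕ-Solver
open import Data.Product.Base using (∃; _,_; proj₁; proj₂; uncurry)
open import Data.Sum.Base using (_⊎_; inj₁; inj₂; [_,_])
open import Data.Unit.Base using (⊤)
open import Data.Vec.Base using (Vec; []; _∷_; _∷ʳ_; lookup)
open import Function.Base using (_∘_)
open import Function.Bundles using (_⇔_; mk⇔; Equivalence)
open import Relation.Binary.PropositionalEquality
  using (_≡_; _≢_; refl; sym; trans; cong; cong₂; subst; subst₂; module ≡-Reasoning)
open import Relation.Nullary.Decidable using (True)
open import Relation.Nullary.Negation using (¬_; contradiction)
open import Algebra.Properties.CommutativeSemigroup ℕ.+-commutativeSemigroup
  using () renaming (interchange to +-interchange)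

private variable
  A B : Set
  k m n p : ℕ

T-injective : ∀ {a b} → T a ⇔ T b → a ≡ b
T-injective {false} {false} _ = refl
T-injective {false} {true}  e = ⊥-elim (Equivalence.from e _)
T-injective {true}  {false} e = ⊥-elim (Equivalence.to e _)
T-injective {true}  {true}  _ = refl

T-not : ∀ {b} → T (not b) ⇔ (¬ T b)
T-not {false} = mk⇔ (λ _ ()) _
T-not {true}  = mk⇔ (λ ()) (λ f → f _)

T-⇒ : ∀ {a b} → T (not a ∨ b) ⇔ (T a → T b)
T-⇒ {false} = mk⇔ (λ _ ()) _
T-⇒ {true}  = mk⇔ (λ t _ → t) (λ f → f _)

T-nand : ∀ {a b} → T (not a ∨ not b) ⇔ (T a → ¬ T b)
T-nand {a} = mk⇔ (λ t → Equivalence.to T-not ∘ Equivalence.to (T-⇒ {a}) t)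
                 (λ f → Equivalence.from (T-⇒ {a}) (Equivalence.from T-not ∘ f))

T-all-allFin : (p : Fin n → Bool) → T (all p (allFin n)) ⇔ (∀ i → T (p i))
T-all-allFin p = mk⇔ (All.tabulate⁻ ∘ All.all⁺ p _) (All.all⁻ p ∘ All.tabulate⁺)

T-any-allFin : (p : Fin n → Bool) → T (any p (allFin n)) ⇔ ∃ λ i → T (p i)
T-any-allFin p = mk⇔ (Any.tabulate⁻ ∘ Any.any⁻ p _) (Any.any⁺ p ∘ uncurry Any.tabulate⁺)

≡ᵇ≡true⇒≡ : ∀ {m n} → (m ≡ᵇ n) ≡ true → m ≡ n
≡ᵇ≡true⇒≡ {m} {n} e = ≡ᵇ⇒≡ m n (subst T (sym e) _)

<ᵇ≡true⇒< : ∀ {m n} → (m <ᵇ n) ≡ true → m < n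
<ᵇ≡true⇒< {m} {n} e = <ᵇ⇒< m n (subst T (sym e) _)

<ᵇ≡false⇒≮ : ∀ {m n} → (m <ᵇ n) ≡ false → m ≮ n
<ᵇ≡false⇒≮ e = subst T e ∘ <⇒<ᵇ

<⇒<ᵇ≡true : ∀ {m n} → m < n → (m <ᵇ n) ≡ true
<⇒<ᵇ≡true {m} {n} m<n with m <ᵇ n | <⇒<ᵇ m<n
... | true | _ = refl

∑ : List A → (A → ℕ) → ℕ
∑ []       f = 0
∑ (x ∷ xs) f = f x + ∑ xs f

syntax ∑ xs (λ x → e) = ∑[ x ∈ xs ] e

𝟙 : Bool → ℕ
𝟙 b = if b then 1 else 0

𝟙-split : ∀ a b → 𝟙 a ≡ 𝟙 (a ∧ not b) + 𝟙 (a ∧ b)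
𝟙-split false b     = refl
𝟙-split true  false = refl
𝟙-split true  true  = refl

length-filter : (p : A → Bool) (xs : List A) →
                length (filter (λ x → p x ≟ᵇ true) xs) ≡ ∑[ x ∈ xs ] 𝟙 (p x)
length-filter p []       = refl
length-filter p (x ∷ xs) with p x
... | true  = cong suc (length-filter p xs)
... | false = length-filter p xs

∑-cong : {f g : A → ℕ} → (∀ x → f x ≡ g x) → (xs : List A) → ∑ xs f ≡ ∑ xs g
∑-cong f≡g []       = refl
∑-cong f≡g (x ∷ xs) = cong₂ _+_ (f≡g x) (∑-cong f≡g xs)

∑-zero : (xs : List A) → ∑[ x ∈ xs ] 0 ≡ 0
∑-zero []       = refl
∑-zero (x ∷ xs) = ∑-zero xs

∑-+ : (f g : A → ℕ) (xs : List A) → ∑[ x ∈ xs ] (f x + g x) ≡ ∑ xs f + ∑ xs g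
∑-+ f g []       = refl
∑-+ f g (x ∷ xs) = begin
  f x + g x + ∑[ y ∈ xs ] (f y + g y)  ≡⟨ cong (f x + g x +_) (∑-+ f g xs) ⟩
  f x + g x + (∑ xs f + ∑ xs g)        ≡⟨ +-interchange (f x) (g x) (∑ xs f) (∑ xs g) ⟩
  f x + ∑ xs f + (g x + ∑ xs g)        ∎
  where open ≡-Reasoning

∑-* : (a : ℕ) (f : A → ℕ) (xs : List A) → ∑[ x ∈ xs ] (a * f x) ≡ a * ∑ xs f
∑-* a f []       = sym (*-zeroʳ a)
∑-* a f (x ∷ xs) = trans (cong (a * f x +_) (∑-* a f xs)) (sym (*-distribˡ-+ a (f x) (∑ xs f)))

∑-++ : (xs ys : List A) (f : A → ℕ) → ∑ (xs ++ ys) f ≡ ∑ xs f + ∑ ys f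
∑-++ []       ys f = refl
∑-++ (x ∷ xs) ys f = trans (cong (f x +_) (∑-++ xs ys f)) (sym (+-assoc (f x) (∑ xs f) (∑ ys f)))

∑-concatMap : (g : A → List B) (xs : List A) (f : B → ℕ) →
              ∑ (concatMap g xs) f ≡ ∑[ x ∈ xs ] ∑ (g x) f
∑-concatMap g []       f = refl
∑-concatMap g (x ∷ xs) f =
  trans (∑-++ (g x) (concatMap g xs) f) (cong (∑ (g x) f +_) (∑-concatMap g xs f))

∑-map : (g : A → B) (xs : List A) (f : B → ℕ) → ∑ (map g xs) f ≡ ∑ xs (f ∘ g)
∑-map g []       f = refl
∑-map g (x ∷ xs) f = cong (f (g x) +_) (∑-map g xs f)

∑-allFin-suc : (f : Fin (suc k) → ℕ) → ∑ (allFin (suc k)) f ≡ f zero + ∑ (allFin k) (f ∘ suc)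
∑-allFin-suc {k} f = cong (f zero +_)
  (trans (cong (λ xs → ∑ xs f) (sym (map-tabulate (λ i → i) suc))) (∑-map suc (allFin k) f))

∑-allVecs-∷ : (f : Vec (Fin k) (suc n) → ℕ) →
              ∑ (allVecs (suc n) k) f ≡ ∑[ c ∈ allFin k ] ∑[ v ∈ allVecs n k ] f (c ∷ v)
∑-allVecs-∷ {k} {n} f =
  trans (∑-concatMap _ (allFin k) f) (∑-cong (λ c → ∑-map (c ∷_) (allVecs n k) f) (allFin k))

∑-allVecs-∷ʳ : (f : Vec (Fin k) (suc n) → ℕ) →
               ∑ (allVecs (suc n) k) f ≡ ∑[ v ∈ allVecs n k ] ∑[ c ∈ allFin k ] f (v ∷ʳ c)
∑-allVecs-∷ʳ {k} {zero}  f = trans (∑-allVecs-∷ f)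
  (trans (∑-cong (λ c → +-identityʳ (f (c ∷ []))) (allFin k)) (sym (+-identityʳ _)))
∑-allVecs-∷ʳ {k} {suc n} f = begin
  ∑ (allVecs (suc (suc n)) k) f
    ≡⟨ ∑-allVecs-∷ f ⟩
  ∑[ c ∈ allFin k ] ∑[ v ∈ allVecs (suc n) k ] f (c ∷ v)
    ≡⟨ ∑-cong (λ c → ∑-allVecs-∷ʳ (f ∘ (c ∷_))) (allFin k) ⟩
  ∑[ c ∈ allFin k ] ∑[ v ∈ allVecs n k ] ∑[ d ∈ allFin k ] f (c ∷ (v ∷ʳ d))
    ≡⟨ ∑-allVecs-∷ (λ v → ∑[ d ∈ allFin k ] f (v ∷ʳ d)) ⟨
  ∑[ v ∈ allVecs (suc n) k ] ∑[ d ∈ allFin k ] f (v ∷ʳ d)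
    ∎
  where open ≡-Reasoning

∑-label-≡ : ∀ a → ∑[ c ∈ allFin k ] 𝟙 (toℕ c ≡ᵇ a) ≡ 𝟙 (a <ᵇ k)
∑-label-≡ {zero}  a       = refl
∑-label-≡ {suc k} zero    =
  trans (∑-allFin-suc {k} (λ c → 𝟙 (toℕ c ≡ᵇ 0))) (cong suc (∑-zero (allFin k)))
∑-label-≡ {suc k} (suc a) =
  trans (∑-allFin-suc {k} (λ c → 𝟙 (toℕ c ≡ᵇ suc a))) (∑-label-≡ {k} a)

∑-label-< : ∀ m → m ≤ k → ∑[ c ∈ allFin k ] 𝟙 (toℕ c <ᵇ m) ≡ m
∑-label-< {k}     zero    _         = ∑-zero (allFin k)
∑-label-< {suc k} (suc m) (s≤s m≤k) =
  trans (∑-allFin-suc {k} (λ c → 𝟙 (toℕ c <ᵇ suc m))) (cong suc (∑-label-< m m≤k))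

-- Stable labellings of the cycle

label : Vec (Fin k) n → Fin n → ℕ
label v i = toℕ (lookup v i)

properAfter : ℕ → Vec (Fin k) n → Bool
properAfter p []       = true
properAfter p (x ∷ xs) = not (toℕ x ≡ᵇ p) ∧ properAfter (toℕ x) xs

lastAfter : ℕ → Vec (Fin k) n → ℕ
lastAfter p []       = p
lastAfter p (x ∷ xs) = lastAfter (toℕ x) xs

Proper : Vec (Fin k) (suc n) → Set
Proper {n = n} v = ∀ i j → toℕ j ≡ suc (toℕ i) % suc n → label v i ≢ label v j

Chain : Vec (Fin k) n → Set
Chain v = ∀ i j → toℕ j ≡ suc (toℕ i) → label v i ≢ label v j

T-stableB : (v : Vec (Fin k) (suc n)) → T (stableB (cycle (suc n)) k v) ⇔ Proper v
T-stableB {k} {n} v = mk⇔ stable⇒proper proper⇒stable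
  where
  open Equivalence
  stable⇒proper : T (stableB (cycle (suc n)) k v) → Proper v
  stable⇒proper h i j j≡i+1 = to T-nand (to (T-all-allFin _) (to (T-all-allFin _) h i) j)
                                        (from T-∨ (inj₁ (≡⇒≡ᵇ _ _ j≡i+1)))
                              ∘ ≡⇒≡ᵇ _ _
  proper⇒stable : Proper v → T (stableB (cycle (suc n)) k v)
  proper⇒stable proper = from (T-all-allFin _) λ i → from (T-all-allFin _) λ j → from T-nand λ adj eq →
    [ (λ j≡i+1 → proper i j (≡ᵇ⇒≡ _ _ j≡i+1) (≡ᵇ⇒≡ _ _ eq))
    , (λ i≡j+1 → proper j i (≡ᵇ⇒≡ _ _ i≡j+1) (sym (≡ᵇ⇒≡ _ _ eq))) ]
    (to T-∨ adj)

Proper⇔Chain×closing : (v : Vec (Fin k) (suc n)) →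
                       Proper v ⇔ (Chain v × label v (fromℕ n) ≢ label v zero)
Proper⇔Chain×closing {n = n} v = mk⇔ proper⇒ ⇒proper
  where
  last-successor : suc (toℕ (fromℕ n)) % suc n ≡ 0
  last-successor = trans (cong (λ t → suc t % suc n) (toℕ-fromℕ n)) (n%n≡0 (suc n))
  proper⇒ : Proper v → Chain v × label v (fromℕ n) ≢ label v zero
  proper⇒ proper = (λ i j j≡i+1 → proper i j (trans j≡i+1 (sym (no-wrap j≡i+1))))
                 , proper (fromℕ n) zero (sym last-successor)
    where
    no-wrap : ∀ {i j} → toℕ j ≡ suc (toℕ i) → suc (toℕ i) % suc n ≡ suc (toℕ i)
    no-wrap {j = j} j≡i+1 = m<n⇒m%n≡m (subst (_< suc n) j≡i+1 (toℕ<n j))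
  ⇒proper : Chain v × label v (fromℕ n) ≢ label v zero → Proper v
  ⇒proper (chain , closing) i j j≡i+1 with m≤n⇒m<n∨m≡n (s≤s⁻¹ (toℕ<n i))
  ... | inj₁ i<n = chain i j (trans j≡i+1 (m<n⇒m%n≡m (s≤s i<n)))
  ... | inj₂ i≡n = subst₂ (λ a b → label v a ≢ label v b) (sym i≡last) (sym j≡first) closing
    where
    i≡last : i ≡ fromℕ n
    i≡last = toℕ-injective (trans i≡n (sym (toℕ-fromℕ n)))
    j≡first : j ≡ zero
    j≡first = toℕ-injective
      (trans j≡i+1 (trans (cong (λ t → suc (toℕ t) % suc n) i≡last) last-successor))

T-properAfter : (x : Fin k) (xs : Vec (Fin k) n) → T (properAfter (toℕ x) xs) ⇔ Chain (x ∷ xs)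
T-properAfter x []       = mk⇔ (λ { _ zero zero () }) _
T-properAfter x (y ∷ ys) = mk⇔ proper⇒ ⇒proper
  where
  open Equivalence
  proper⇒ : T (properAfter (toℕ x) (y ∷ ys)) → Chain (x ∷ y ∷ ys)
  proper⇒ h zero    (suc zero) _ = to T-not (proj₁ (to T-∧ h)) ∘ ≡⇒≡ᵇ _ _ ∘ sym
  proper⇒ h (suc i) (suc j)    e = to (T-properAfter y ys) (proj₂ (to T-∧ h)) i j (suc-injective e)
  ⇒proper : Chain (x ∷ y ∷ ys) → T (properAfter (toℕ x) (y ∷ ys))
  ⇒proper chain = from T-∧ ( from T-not (chain zero (suc zero) refl ∘ sym ∘ ≡ᵇ⇒≡ _ _)
                           , from (T-properAfter y ys) λ i j e → chain (suc i) (suc j) (cong suc e))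

lastAfter-lookup : (x : Fin k) (xs : Vec (Fin k) n) → lastAfter (toℕ x) xs ≡ label (x ∷ xs) (fromℕ n)
lastAfter-lookup x []       = refl
lastAfter-lookup x (y ∷ ys) = lastAfter-lookup y ys

stableB-cycle : (x : Fin k) (xs : Vec (Fin k) n) →
  stableB (cycle (suc n)) k (x ∷ xs) ≡ properAfter (toℕ x) xs ∧ not (lastAfter (toℕ x) xs ≡ᵇ toℕ x)
stableB-cycle {k} {n} x xs = T-injective (mk⇔ stable⇒ ⇒stable)
  where
  open Equivalence
  proper-cycle : Bool
  proper-cycle = properAfter (toℕ x) xs ∧ not (lastAfter (toℕ x) xs ≡ᵇ toℕ x)
  stable⇒ : T (stableB (cycle (suc n)) k (x ∷ xs)) → T proper-cycle
  stable⇒ h = let (chain , closing) = to (Proper⇔Chain×closing (x ∷ xs)) (to (T-stableB (x ∷ xs)) h) in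
    from T-∧ ( from (T-properAfter x xs) chain
             , from T-not (closing ∘ trans (sym (lastAfter-lookup x xs)) ∘ ≡ᵇ⇒≡ _ _))
  ⇒stable : T proper-cycle → T (stableB (cycle (suc n)) k (x ∷ xs))
  ⇒stable h = let (proper , closing) = to T-∧ h in
    from (T-stableB (x ∷ xs)) (from (Proper⇔Chain×closing (x ∷ xs))
      (to (T-properAfter x xs) proper , to T-not closing ∘ ≡⇒≡ᵇ _ _ ∘ trans (lastAfter-lookup x xs)))

-- Canonical labellings as restricted growth strings

restrictedGrowth : (k : ℕ) → ℕ → Vec (Fin k) n → Bool
restrictedGrowth k m []       = m ≡ᵇ k
restrictedGrowth k m (x ∷ xs) =
  if toℕ x <ᵇ m then restrictedGrowth k m xs else (toℕ x ≡ᵇ m) ∧ restrictedGrowth k (suc m) xs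

Canonical : ℕ → Vec (Fin k) n → Set
Canonical {k} m v = ∀ i (c : Fin k) → toℕ c < label v i →
  toℕ c < m ⊎ ∃ λ j → toℕ j < toℕ i × label v j ≡ toℕ c

Covering : ℕ → Vec (Fin k) n → Set
Covering {k} m v = ∀ (c : Fin k) → toℕ c < m ⊎ ∃ λ i → label v i ≡ toℕ c

<-suc-split : ∀ {c m} → c < suc m → c < m ⊎ c ≡ m
<-suc-split = m≤n⇒m<n∨m≡n ∘ s≤s⁻¹

restrictedGrowth-sound : (v : Vec (Fin k) n) → T (restrictedGrowth k m v) → Canonical m v × Covering m v
restrictedGrowth-sound {k} {m = m} [] h =
  (λ ()) , λ c → inj₁ (subst (toℕ c <_) (sym (≡ᵇ⇒≡ m k h)) (toℕ<n c))
restrictedGrowth-sound {m = m} (x ∷ xs) h with toℕ x <ᵇ m in x<m?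
... | true = canonical , covering
  where
  ih : Canonical m xs × Covering m xs
  ih = restrictedGrowth-sound xs h
  canonical : Canonical m (x ∷ xs)
  canonical zero    c c<x = inj₁ (<-trans c<x (<ᵇ≡true⇒< x<m?))
  canonical (suc i) c c<v with proj₁ ih i c c<v
  ... | inj₁ c<m             = inj₁ c<m
  ... | inj₂ (j , j<i , v≡c) = inj₂ (suc j , s<s j<i , v≡c)
  covering : Covering m (x ∷ xs)
  covering c with proj₂ ih c
  ... | inj₁ c<m       = inj₁ c<m
  ... | inj₂ (i , v≡c) = inj₂ (suc i , v≡c)
... | false = canonical , covering
  where
  x≡m : toℕ x ≡ m
  x≡m = ≡ᵇ⇒≡ _ _ (proj₁ (Equivalence.to T-∧ h))
  ih : Canonical (suc m) xs × Covering (suc m) xs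
  ih = restrictedGrowth-sound xs (proj₂ (Equivalence.to T-∧ h))
  canonical : Canonical m (x ∷ xs)
  canonical zero    c c<x = inj₁ (subst (toℕ c <_) x≡m c<x)
  canonical (suc i) c c<v with proj₁ ih i c c<v
  ... | inj₂ (j , j<i , v≡c) = inj₂ (suc j , s<s j<i , v≡c)
  ... | inj₁ c<1+m with <-suc-split c<1+m
  ...   | inj₁ c<m = inj₁ c<m
  ...   | inj₂ c≡m = inj₂ (zero , z<s , trans x≡m (sym c≡m))
  covering : Covering m (x ∷ xs)
  covering c with proj₂ ih c
  ... | inj₂ (i , v≡c) = inj₂ (suc i , v≡c)
  ... | inj₁ c<1+m with <-suc-split c<1+m
  ...   | inj₁ c<m = inj₁ c<m
  ...   | inj₂ c≡m = inj₂ (zero , trans x≡m (sym c≡m))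

restrictedGrowth-complete : (v : Vec (Fin k) n) → m ≤ k → Canonical m v → Covering m v →
                            T (restrictedGrowth k m v)
restrictedGrowth-complete {k} {m = m} [] m≤k _ covering with m≤n⇒m<n∨m≡n m≤k
... | inj₂ m≡k = ≡⇒≡ᵇ m k m≡k
... | inj₁ m<k with covering (fromℕ< m<k)
...   | inj₁ m<m = ⊥-elim (<-irrefl (toℕ-fromℕ< m<k) m<m)
...   | inj₂ (() , _)
restrictedGrowth-complete {k} {m = m} (x ∷ xs) m≤k canonical covering with toℕ x <ᵇ m in x<m?
... | true = restrictedGrowth-complete xs m≤k canonical′ covering′
  where
  canonical′ : Canonical m xs
  canonical′ i c c<v with canonical (suc i) c c<v
  ... | inj₁ c<m                 = inj₁ c<m
  ... | inj₂ (zero , _ , x≡c)    = inj₁ (subst (_< m) x≡c (<ᵇ≡true⇒< x<m?))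
  ... | inj₂ (suc j , j<i , v≡c) = inj₂ (j , s<s⁻¹ j<i , v≡c)
  covering′ : Covering m xs
  covering′ c with covering c
  ... | inj₁ c<m           = inj₁ c<m
  ... | inj₂ (zero , x≡c)  = inj₁ (subst (_< m) x≡c (<ᵇ≡true⇒< x<m?))
  ... | inj₂ (suc i , v≡c) = inj₂ (i , v≡c)
... | false =
  Equivalence.from T-∧ (≡⇒≡ᵇ _ _ x≡m , restrictedGrowth-complete xs 1+m≤k canonical′ covering′)
  where
  x≡m : toℕ x ≡ m
  x≡m with m≤n⇒m<n∨m≡n (≮⇒≥ (<ᵇ≡false⇒≮ x<m?))
  ... | inj₂ m≡x = sym m≡x
  ... | inj₁ m<x with canonical zero (fromℕ< (<-trans m<x (toℕ<n x)))
                                     (subst (_< toℕ x) (sym (toℕ-fromℕ< _)) m<x)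
  ...   | inj₁ m<m = ⊥-elim (<-irrefl (toℕ-fromℕ< _) m<m)
  ...   | inj₂ (_ , () , _)
  1+m≤k : suc m ≤ k
  1+m≤k = subst (λ t → suc t ≤ k) x≡m (toℕ<n x)
  below : ∀ {c} → c ≡ toℕ x → c < suc m
  below c≡x = s≤s (subst (_≤ m) (sym (trans c≡x x≡m)) ≤-refl)
  canonical′ : Canonical (suc m) xs
  canonical′ i c c<v with canonical (suc i) c c<v
  ... | inj₁ c<m                 = inj₁ (<-trans c<m (n<1+n m))
  ... | inj₂ (zero , _ , x≡c)    = inj₁ (below (sym x≡c))
  ... | inj₂ (suc j , j<i , v≡c) = inj₂ (j , s<s⁻¹ j<i , v≡c)
  covering′ : Covering (suc m) xs
  covering′ c with covering c
  ... | inj₁ c<m           = inj₁ (<-trans c<m (n<1+n m))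
  ... | inj₂ (zero , x≡c)  = inj₁ (below (sym x≡c))
  ... | inj₂ (suc i , v≡c) = inj₂ (i , v≡c)

surjB∧canonB : (H : Graph) (v : Vec (Fin k) (size H)) →
               surjB H k v ∧ canonB H k v ≡ restrictedGrowth k 0 v
surjB∧canonB {k} H v = T-injective (mk⇔ ⇒restricted restricted⇒)
  where
  open Equivalence
  Earlier : Fin (size H) → Fin k → Bool
  Earlier i c = any (λ j → (toℕ j <ᵇ toℕ i) ∧ (lookup v j =ᶠ c)) (allFin (size H))
  ⇒restricted : T (surjB H k v ∧ canonB H k v) → T (restrictedGrowth k 0 v)
  ⇒restricted h = restrictedGrowth-complete v z≤n canonical covering
    where
    covering : Covering 0 v
    covering c with to (T-any-allFin _) (to (T-all-allFin _) (proj₁ (to T-∧ h)) c)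
    ... | i , v≡c = inj₂ (i , ≡ᵇ⇒≡ _ _ v≡c)
    canonical : Canonical 0 v
    canonical i c c<v with to (T-any-allFin _) (to T-⇒ (to (T-all-allFin _)
                             (to (T-all-allFin _) (proj₂ (to T-∧ h)) i) c) (<⇒<ᵇ c<v))
    ... | j , t = let (j<i , v≡c) = to T-∧ t in inj₂ (j , <ᵇ⇒< _ _ j<i , ≡ᵇ⇒≡ _ _ v≡c)
  restricted⇒ : T (restrictedGrowth k 0 v) → T (surjB H k v ∧ canonB H k v)
  restricted⇒ h =
    from T-∧ (from (T-all-allFin _) surj , from (T-all-allFin _) λ i → from (T-all-allFin _) (canon i))
    where
    sound : Canonical 0 v × Covering 0 v
    sound = restrictedGrowth-sound v h
    surj : ∀ c → T (any (λ i → lookup v i =ᶠ c) (allFin (size H)))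
    surj c with proj₂ sound c
    ... | inj₂ (i , v≡c) = from (T-any-allFin _) (i , ≡⇒≡ᵇ _ _ v≡c)
    earlier : ∀ {i c} → toℕ c < 0 ⊎ ∃ (λ j → toℕ j < toℕ i × label v j ≡ toℕ c) → T (Earlier i c)
    earlier (inj₂ (j , j<i , v≡c)) = from (T-any-allFin _) (j , from T-∧ (<⇒<ᵇ j<i , ≡⇒≡ᵇ _ _ v≡c))
    canon : ∀ i c → T (not (toℕ c <ᵇ label v i) ∨ Earlier i c)
    canon i c = from T-⇒ λ c<v → earlier (proj₁ sound i c (<ᵇ⇒< _ _ c<v))

-- The labelling automaton

-- (number of labels used so far, last label)
State : Set
State = ℕ × ℕ

step : ℕ → State → Maybe State
step c (m , p) =
  if c ≡ᵇ p then nothing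
  else if c <ᵇ m then just (m , c)
  else if c ≡ᵇ m then just (suc m , c)
  else nothing

run : Maybe State → Vec (Fin k) n → Maybe State
run s []       = s
run s (x ∷ xs) = run (s >>= step (toℕ x)) xs

closes : ℕ → Maybe State → Bool
closes k (just (m , p)) = (m ≡ᵇ k) ∧ not (p ≡ᵇ 0)
closes k nothing        = false

run-nothing : (xs : Vec (Fin k) n) → run nothing xs ≡ nothing
run-nothing []       = refl
run-nothing (x ∷ xs) = run-nothing xs

run-∷ʳ : (s : Maybe State) (xs : Vec (Fin k) n) (c : Fin k) →
         run s (xs ∷ʳ c) ≡ (run s xs >>= step (toℕ c))
run-∷ʳ s []       c = refl
run-∷ʳ s (x ∷ xs) c = run-∷ʳ (s >>= step (toℕ x)) xs c

closes-run : ∀ m p (xs : Vec (Fin k) n) →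
  closes k (run (just (m , p)) xs) ≡ restrictedGrowth k m xs ∧ properAfter p xs ∧ not (lastAfter p xs ≡ᵇ 0)
closes-run m p []       = refl
closes-run m p (x ∷ xs) with toℕ x ≡ᵇ p | toℕ x <ᵇ m | toℕ x ≡ᵇ m
... | true  | _     | _     rewrite run-nothing xs = sym (∧-zeroʳ _)
... | false | true  | _     = closes-run m (toℕ x) xs
... | false | false | true  = closes-run (suc m) (toℕ x) xs
... | false | false | false rewrite run-nothing xs = refl

isStablePartition-cycle : (x : Fin k) (xs : Vec (Fin k) n) →
  isStablePartition (cycle (suc n)) k (x ∷ xs) ≡ (toℕ x ≡ᵇ 0) ∧ closes k (run (just (1 , 0)) xs)
isStablePartition-cycle {k} {n} x xs =
  trans (cong₂ _∧_ (stableB-cycle x xs) (surjB∧canonB (cycle (suc n)) (x ∷ xs))) (by-first-label (toℕ x))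
  where
  by-first-label : ∀ t →
    (properAfter t xs ∧ not (lastAfter t xs ≡ᵇ t)) ∧ (t ≡ᵇ 0) ∧ restrictedGrowth k 1 xs
    ≡ (t ≡ᵇ 0) ∧ closes k (run (just (1 , 0)) xs)
  by-first-label zero    =
    trans (∧-comm (properAfter 0 xs ∧ _) (restrictedGrowth k 1 xs)) (sym (closes-run 1 0 xs))
  by-first-label (suc t) = ∧-zeroʳ _

-- Counting labellings by their last label

Reachable : ℕ → Maybe State → Set
Reachable k nothing        = ⊤
Reachable k (just (m , p)) = p < m × m ≤ k

step-reachable : ∀ {c} → c < k → (s : Maybe State) → Reachable k s → Reachable k (s >>= step c)
step-reachable             c<k nothing        _ = _
step-reachable {k} {c} c<k (just (m , p)) (p<m , m≤k) with c ≡ᵇ p | c <ᵇ m in c<m? | c ≡ᵇ m in c≡m?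
... | true  | _     | _     = _
... | false | true  | _     = <ᵇ≡true⇒< c<m? , m≤k
... | false | false | true  = subst (_< suc m) (sym (≡ᵇ≡true⇒≡ c≡m?)) (n<1+n m)
                            , subst (λ t → suc t ≤ k) (≡ᵇ≡true⇒≡ c≡m?) c<k
... | false | false | false = _

run-reachable : (s : Maybe State) (xs : Vec (Fin k) n) → Reachable k s → Reachable k (run s xs)
run-reachable s []       r = r
run-reachable s (x ∷ xs) r = run-reachable (s >>= step (toℕ x)) xs (step-reachable (toℕ<n x) s r)

-- The successors of (m , p) are (m , c) for c < m, c ≢ p, and (m + 1 , m).
step-split : (g : Maybe State → ℕ) → g nothing ≡ 0 → ∀ c → p < m →
  g (step c (m , p)) + g (just (m , p)) * 𝟙 (c ≡ᵇ p)
  ≡ g (just (m , c)) * 𝟙 (c <ᵇ m) + g (just (suc m , m)) * 𝟙 (c ≡ᵇ m)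
step-split {p} {m} g g∅ c p<m with c ≡ᵇ p in c≡p? | c <ᵇ m in c<m? | c ≡ᵇ m in c≡m?
... | true  | true  | true  =
  contradiction (trans (sym (≡ᵇ≡true⇒≡ {c} c≡p?)) (≡ᵇ≡true⇒≡ {c} c≡m?)) (<⇒≢ p<m)
... | true  | true  | false rewrite g∅ | *-zeroʳ (g (just (suc m , m))) =
  trans (cong (λ t → g (just (m , t)) * 1) (sym (≡ᵇ≡true⇒≡ c≡p?))) (sym (+-identityʳ _))
... | true  | false | _     = contradiction (subst (_< m) (sym (≡ᵇ≡true⇒≡ c≡p?)) p<m) (<ᵇ≡false⇒≮ c<m?)
... | false | true  | true  = contradiction (subst (_< m) (≡ᵇ≡true⇒≡ c≡m?) (<ᵇ≡true⇒< c<m?)) (<-irrefl refl)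
... | false | true  | false rewrite *-zeroʳ (g (just (m , p))) | *-zeroʳ (g (just (suc m , m))) =
  cong (_+ 0) (sym (*-identityʳ _))
... | false | false | true  rewrite *-zeroʳ (g (just (m , p))) | *-zeroʳ (g (just (m , c))) =
  trans (+-identityʳ _)
        (trans (cong (λ t → g (just (suc m , t))) (≡ᵇ≡true⇒≡ c≡m?)) (sym (*-identityʳ _)))
... | false | false | false
  rewrite g∅ | *-zeroʳ (g (just (m , p))) | *-zeroʳ (g (just (m , c))) | *-zeroʳ (g (just (suc m , m))) = refl

∑-step : (g : Maybe State → ℕ) → g nothing ≡ 0 → p < m → p < k →
  ∑[ c ∈ allFin k ] g (step (toℕ c) (m , p)) + g (just (m , p))
  ≡ ∑[ c ∈ allFin k ] (g (just (m , toℕ c)) * 𝟙 (toℕ c <ᵇ m)) + g (just (suc m , m)) * 𝟙 (m <ᵇ k)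
∑-step {p} {m} {k} g g∅ p<m p<k = begin
  ∑[ c ∈ allFin k ] g (step (toℕ c) (m , p)) + g (just (m , p))
    ≡⟨ cong (∑[ c ∈ allFin k ] g (step (toℕ c) (m , p)) +_) predecessor ⟨
  ∑[ c ∈ allFin k ] g (step (toℕ c) (m , p)) + ∑[ c ∈ allFin k ] (g (just (m , p)) * 𝟙 (toℕ c ≡ᵇ p))
    ≡⟨ ∑-+ _ _ (allFin k) ⟨
  ∑[ c ∈ allFin k ] (g (step (toℕ c) (m , p)) + g (just (m , p)) * 𝟙 (toℕ c ≡ᵇ p))
    ≡⟨ ∑-cong (λ c → step-split g g∅ (toℕ c) p<m) (allFin k) ⟩
  ∑[ c ∈ allFin k ] (g (just (m , toℕ c)) * 𝟙 (toℕ c <ᵇ m)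
                      + g (just (suc m , m)) * 𝟙 (toℕ c ≡ᵇ m))
    ≡⟨ ∑-+ _ _ (allFin k) ⟩
  ∑[ c ∈ allFin k ] (g (just (m , toℕ c)) * 𝟙 (toℕ c <ᵇ m))
    + ∑[ c ∈ allFin k ] (g (just (suc m , m)) * 𝟙 (toℕ c ≡ᵇ m))
    ≡⟨ cong (∑[ c ∈ allFin k ] (g (just (m , toℕ c)) * 𝟙 (toℕ c <ᵇ m)) +_) new-label ⟩
  ∑[ c ∈ allFin k ] (g (just (m , toℕ c)) * 𝟙 (toℕ c <ᵇ m)) + g (just (suc m , m)) * 𝟙 (m <ᵇ k)
    ∎
  where
  open ≡-Reasoning
  predecessor : ∑[ c ∈ allFin k ] (g (just (m , p)) * 𝟙 (toℕ c ≡ᵇ p)) ≡ g (just (m , p))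
  predecessor rewrite ∑-* (g (just (m , p))) (λ c → 𝟙 (toℕ c ≡ᵇ p)) (allFin k)
                    | ∑-label-≡ {k} p | <⇒<ᵇ≡true p<k = *-identityʳ _
  new-label : ∑[ c ∈ allFin k ] (g (just (suc m , m)) * 𝟙 (toℕ c ≡ᵇ m)) ≡ g (just (suc m , m)) * 𝟙 (m <ᵇ k)
  new-label = trans (∑-* (g (just (suc m , m))) (λ c → 𝟙 (toℕ c ≡ᵇ m)) (allFin k))
                    (cong (g (just (suc m , m)) *_) (∑-label-≡ {k} m))

used : ℕ → Maybe State → Bool
used j (just (m , _)) = m ≡ᵇ j
used j nothing        = false

endsAtZero : ℕ → Maybe State → Bool
endsAtZero j (just (m , p)) = (m ≡ᵇ j) ∧ (p ≡ᵇ 0)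
endsAtZero j nothing        = false

𝟙-≡ᵇ-* : ∀ m j → 𝟙 (m ≡ᵇ j) * m ≡ j * 𝟙 (m ≡ᵇ j)
𝟙-≡ᵇ-* m j with m ≡ᵇ j in m≡j?
... | true  rewrite ≡ᵇ≡true⇒≡ {m} m≡j? = *-comm 1 j
... | false = sym (*-zeroʳ j)

𝟙-≡ᵇ-<ᵇ : ∀ m i → i < k → 𝟙 (m ≡ᵇ i) * 𝟙 (m <ᵇ k) ≡ 𝟙 (m ≡ᵇ i)
𝟙-≡ᵇ-<ᵇ m i i<k with m ≡ᵇ i in m≡i?
... | true  rewrite ≡ᵇ≡true⇒≡ {m} m≡i? | <⇒<ᵇ≡true i<k = refl
... | false = refl

𝟙-label-zero : ∀ a c m → 𝟙 (a ∧ (c ≡ᵇ 0)) * 𝟙 (c <ᵇ suc m) ≡ 𝟙 a * 𝟙 (c ≡ᵇ 0)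
𝟙-label-zero false c       m = refl
𝟙-label-zero true  zero    m = refl
𝟙-label-zero true  (suc c) m = refl

𝟙-used : ∀ j s → 𝟙 (used j s) ≡ 𝟙 (closes j s) + 𝟙 (endsAtZero j s)
𝟙-used j nothing        = refl
𝟙-used j (just (m , p)) = 𝟙-split (m ≡ᵇ j) (p ≡ᵇ 0)

∑-used : ∀ i → suc i ≤ k → (s : Maybe State) → Reachable k s →
  ∑[ c ∈ allFin k ] 𝟙 (used (suc i) (s >>= step (toℕ c))) ≡ i * 𝟙 (used (suc i) s) + 𝟙 (used i s)
∑-used {k} i _     nothing        _ = trans (∑-zero (allFin k)) (sym (cong (_+ 0) (*-zeroʳ i)))
∑-used {k} i 1+i≤k (just (m , p)) (p<m , m≤k) = +-cancelʳ-≡ K _ _ (begin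
  ∑[ c ∈ allFin k ] 𝟙 (used (suc i) (step (toℕ c) (m , p))) + K
    ≡⟨ ∑-step (𝟙 ∘ used (suc i)) refl p<m (<-≤-trans p<m m≤k) ⟩
  ∑[ c ∈ allFin k ] (K * 𝟙 (toℕ c <ᵇ m)) + L * 𝟙 (m <ᵇ k)
    ≡⟨ cong₂ _+_ (trans (∑-* K _ (allFin k)) (cong (K *_) (∑-label-< m m≤k))) (𝟙-≡ᵇ-<ᵇ m i 1+i≤k) ⟩
  K * m + L
    ≡⟨ cong (_+ L) (𝟙-≡ᵇ-* m (suc i)) ⟩
  K + i * K + L
    ≡⟨ +-assoc K (i * K) L ⟩
  K + (i * K + L)
    ≡⟨ +-comm K (i * K + L) ⟩
  i * K + L + K ∎)
  where
  open ≡-Reasoning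
  K L : ℕ
  K = 𝟙 (m ≡ᵇ suc i)
  L = 𝟙 (m ≡ᵇ i)

∑-endsAtZero : ∀ j → 0 < k → (s : Maybe State) → Reachable k s →
  ∑[ c ∈ allFin k ] 𝟙 (endsAtZero j (s >>= step (toℕ c))) ≡ 𝟙 (closes j s)
∑-endsAtZero {k} j _ nothing _ = ∑-zero (allFin k)
∑-endsAtZero {suc k} j _ (just (suc m , p)) (p<m , m≤k) = +-cancelʳ-≡ Z _ _ (begin
  ∑[ c ∈ allFin (suc k) ] 𝟙 (endsAtZero j (step (toℕ c) (suc m , p))) + Z
    ≡⟨ ∑-step (𝟙 ∘ endsAtZero j) refl p<m (<-≤-trans p<m m≤k) ⟩
  ∑[ c ∈ allFin (suc k) ] (𝟙 (a ∧ (toℕ c ≡ᵇ 0)) * 𝟙 (toℕ c <ᵇ suc m))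
    + 𝟙 ((suc (suc m) ≡ᵇ j) ∧ false) * 𝟙 (suc m <ᵇ suc k)
    ≡⟨ cong₂ _+_ zero-successor
                 (cong (λ b → 𝟙 b * 𝟙 (suc m <ᵇ suc k)) (∧-zeroʳ (suc (suc m) ≡ᵇ j))) ⟩
  𝟙 a + 0
    ≡⟨ trans (+-identityʳ (𝟙 a)) (𝟙-split a (p ≡ᵇ 0)) ⟩
  𝟙 (a ∧ not (p ≡ᵇ 0)) + Z ∎)
  where
  open ≡-Reasoning
  a : Bool
  a = suc m ≡ᵇ j
  Z : ℕ
  Z = 𝟙 (a ∧ (p ≡ᵇ 0))
  zero-successor : ∑[ c ∈ allFin (suc k) ] (𝟙 (a ∧ (toℕ c ≡ᵇ 0)) * 𝟙 (toℕ c <ᵇ suc m)) ≡ 𝟙 a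
  zero-successor = begin
    ∑[ c ∈ allFin (suc k) ] (𝟙 (a ∧ (toℕ c ≡ᵇ 0)) * 𝟙 (toℕ c <ᵇ suc m))
      ≡⟨ ∑-cong (λ c → 𝟙-label-zero a (toℕ c) m) (allFin (suc k)) ⟩
    ∑[ c ∈ allFin (suc k) ] (𝟙 a * 𝟙 (toℕ c ≡ᵇ 0))
      ≡⟨ ∑-* (𝟙 a) _ (allFin (suc k)) ⟩
    𝟙 a * ∑[ c ∈ allFin (suc k) ] 𝟙 (toℕ c ≡ᵇ 0)
      ≡⟨ cong (𝟙 a *_) (∑-label-≡ {suc k} 0) ⟩
    𝟙 a * 1
      ≡⟨ *-identityʳ (𝟙 a) ⟩
    𝟙 a ∎

-- The number of labellings x₁ … xₙ such that 0 x₁ … xₙ leads the automaton to a state satisfying P.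
labellings : (k : ℕ) → (Maybe State → Bool) → ℕ → ℕ
labellings k P n = ∑[ v ∈ allVecs n k ] 𝟙 (P (run (just (1 , 0)) v))

labellings-suc : (P : Maybe State → Bool) → labellings k P (suc n) ≡
  ∑[ v ∈ allVecs n k ] ∑[ c ∈ allFin k ] 𝟙 (P (run (just (1 , 0)) v >>= step (toℕ c)))
labellings-suc {k} {n} P = trans (∑-allVecs-∷ʳ {k} {n} (𝟙 ∘ P ∘ run (just (1 , 0))))
  (∑-cong (λ v → ∑-cong (λ c → cong (𝟙 ∘ P) (run-∷ʳ (just (1 , 0)) v c)) (allFin k)) (allVecs n k))

reachable : 0 < k → (v : Vec (Fin k) n) → Reachable k (run (just (1 , 0)) v)
reachable 0<k v = run-reachable (just (1 , 0)) v (z<s , 0<k)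

labellings-used-suc : ∀ i → suc i ≤ k →
  labellings k (used (suc i)) (suc n) ≡ i * labellings k (used (suc i)) n + labellings k (used i) n
labellings-used-suc {k} {n} i 1+i≤k = begin
  labellings k (used (suc i)) (suc n)
    ≡⟨ labellings-suc {k} {n} (used (suc i)) ⟩
  ∑[ v ∈ allVecs n k ] ∑[ c ∈ allFin k ] 𝟙 (used (suc i) (run (just (1 , 0)) v >>= step (toℕ c)))
    ≡⟨ ∑-cong (λ v → ∑-used i 1+i≤k _ (reachable (<-≤-trans z<s 1+i≤k) v)) (allVecs n k) ⟩
  ∑[ v ∈ allVecs n k ] (i * 𝟙 (used (suc i) (run (just (1 , 0)) v)) + 𝟙 (used i (run (just (1 , 0)) v)))
    ≡⟨ ∑-+ _ _ (allVecs n k) ⟩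
  ∑[ v ∈ allVecs n k ] (i * 𝟙 (used (suc i) (run (just (1 , 0)) v))) + labellings k (used i) n
    ≡⟨ cong (_+ labellings k (used i) n) (∑-* i _ (allVecs n k)) ⟩
  i * labellings k (used (suc i)) n + labellings k (used i) n ∎
  where open ≡-Reasoning

labellings-used-zero : 0 < k → ∀ n → labellings k (used 0) n ≡ 0
labellings-used-zero {k} 0<k n = trans (∑-cong none (allVecs n k)) (∑-zero (allVecs n k))
  where
  none : (v : Vec (Fin k) n) → 𝟙 (used 0 (run (just (1 , 0)) v)) ≡ 0
  none v with run (just (1 , 0)) v | reachable 0<k v
  ... | nothing          | _ = refl
  ... | just (suc m , p) | _ = refl

labellings-endsAtZero-suc : ∀ j → 0 < k → labellings k (endsAtZero j) (suc n) ≡ labellings k (closes j) n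
labellings-endsAtZero-suc {k} {n} j 0<k = trans (labellings-suc {k} {n} (endsAtZero j))
  (∑-cong (λ v → ∑-endsAtZero j 0<k _ (reachable 0<k v)) (allVecs n k))

labellings-used : ∀ j n →
  labellings k (used j) n ≡ labellings k (closes j) n + labellings k (endsAtZero j) n
labellings-used {k} j n =
  trans (∑-cong (λ v → 𝟙-used j (run (just (1 , 0)) v)) (allVecs n k)) (∑-+ _ _ (allVecs n k))

stirling : ℕ → ℕ → ℕ
stirling zero    zero    = 1
stirling zero    (suc k) = 0
stirling (suc n) zero    = 0
stirling (suc n) (suc k) = suc k * stirling n (suc k) + stirling n k

labellings-used≡stirling : ∀ i n → suc i ≤ k → labellings k (used (suc i)) n ≡ stirling n i
labellings-used≡stirling zero    zero    _     = refl
labellings-used≡stirling (suc i) zero    _     = refl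
labellings-used≡stirling zero    (suc n) 1≤k   =
  trans (labellings-used-suc 0 1≤k) (labellings-used-zero 1≤k n)
labellings-used≡stirling (suc i) (suc n) 2+i≤k = trans (labellings-used-suc (suc i) 2+i≤k)
  (cong₂ (λ a b → suc i * a + b) (labellings-used≡stirling (suc i) n 2+i≤k)
                                 (labellings-used≡stirling i n (<-trans (n<1+n _) 2+i≤k)))

S-cycle : 0 < k → ∀ n → S (cycle (suc n)) k ≡ labellings k (closes k) n
S-cycle {k} 0<k n = begin
  S (cycle (suc n)) k
    ≡⟨ length-filter (isStablePartition (cycle (suc n)) k) (allVecs (suc n) k) ⟩
  ∑[ v ∈ allVecs (suc n) k ] 𝟙 (isStablePartition (cycle (suc n)) k v)
    ≡⟨ ∑-allVecs-∷ {k} {n} _ ⟩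
  ∑[ x ∈ allFin k ] ∑[ v ∈ allVecs n k ] 𝟙 (isStablePartition (cycle (suc n)) k (x ∷ v))
    ≡⟨ ∑-cong (λ x → ∑-cong (λ v → cong 𝟙 (isStablePartition-cycle x v)) (allVecs n k)) (allFin k) ⟩
  ∑[ x ∈ allFin k ] ∑[ v ∈ allVecs n k ] 𝟙 ((toℕ x ≡ᵇ 0) ∧ closes k (run (just (1 , 0)) v))
    ≡⟨ ∑-cong (λ x → first-label (toℕ x ≡ᵇ 0)) (allFin k) ⟩
  ∑[ x ∈ allFin k ] (C * 𝟙 (toℕ x ≡ᵇ 0))
    ≡⟨ ∑-* C (λ x → 𝟙 (toℕ x ≡ᵇ 0)) (allFin k) ⟩
  C * ∑[ x ∈ allFin k ] 𝟙 (toℕ x ≡ᵇ 0)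
    ≡⟨ cong (C *_) (trans (∑-label-≡ {k} 0) (cong 𝟙 (<⇒<ᵇ≡true 0<k))) ⟩
  C * 1
    ≡⟨ *-identityʳ C ⟩
  C ∎
  where
  open ≡-Reasoning
  C : ℕ
  C = labellings k (closes k) n
  first-label : ∀ a → ∑[ v ∈ allVecs n k ] 𝟙 (a ∧ closes k (run (just (1 , 0)) v)) ≡ C * 𝟙 a
  first-label false = trans (∑-zero (allVecs n k)) (sym (*-zeroʳ C))
  first-label true  = sym (*-identityʳ C)

S-cycle-one : ∀ k → S (cycle 1) k ≡ 0
S-cycle-one zero    = refl
S-cycle-one (suc k) = trans (S-cycle {suc k} z<s 0) (cong (λ b → 𝟙 b + 0) (∧-zeroʳ (1 ≡ᵇ suc k)))

S-cycle-stirling : ∀ i n → S (cycle (suc (suc n))) (suc i) + S (cycle (suc n)) (suc i) ≡ stirling (suc n) i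
S-cycle-stirling i n = begin
  S (cycle (suc (suc n))) (suc i) + S (cycle (suc n)) (suc i)
    ≡⟨ cong₂ _+_ (S-cycle {suc i} z<s (suc n)) (S-cycle {suc i} z<s n) ⟩
  labellings (suc i) (closes (suc i)) (suc n) + labellings (suc i) (closes (suc i)) n
    ≡⟨ cong (labellings (suc i) (closes (suc i)) (suc n) +_)
            (labellings-endsAtZero-suc {suc i} {n} (suc i) z<s) ⟨
  labellings (suc i) (closes (suc i)) (suc n) + labellings (suc i) (endsAtZero (suc i)) (suc n)
    ≡⟨ labellings-used {suc i} (suc i) (suc n) ⟨
  labellings (suc i) (used (suc i)) (suc n)
    ≡⟨ labellings-used≡stirling {suc i} i (suc n) ≤-refl ⟩
  stirling (suc n) i ∎
  where open ≡-Reasoning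

-- Closed forms

open import Data.Integer.Base using (ℤ; +_; -_; 0ℤ)

basis : Vec ℤ 6
basis = + 5 ∷ + 4 ∷ + 3 ∷ + 2 ∷ + 1 ∷ - + 1 ∷ []

-- Coefficients over basis of j! S(N, j) = Σᵢ (-1)^(j-i) C(j,i) iᴺ and, by inclusion–exclusion
-- from the chromatic polynomial (x-1)ᴺ + (-1)ᴺ (x-1) of C_N,
-- k! S(C_N, k) = Σᵢ (-1)^(k-i) C(k,i) ((i-1)ᴺ + (-1)ᴺ (i-1)); both for N ≥ 1.
stirlingPoly : ℕ → Vec ℤ 6
stirlingPoly 1 = + 0 ∷ + 0   ∷ + 0   ∷ + 0    ∷ + 1   ∷ + 0 ∷ []
stirlingPoly 2 = + 0 ∷ + 0   ∷ + 0   ∷ + 1    ∷ - + 2 ∷ + 0 ∷ []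
stirlingPoly 3 = + 0 ∷ + 0   ∷ + 1   ∷ - + 3  ∷ + 3   ∷ + 0 ∷ []
stirlingPoly 4 = + 0 ∷ + 1   ∷ - + 4 ∷ + 6    ∷ - + 4 ∷ + 0 ∷ []
stirlingPoly 5 = + 1 ∷ - + 5 ∷ + 10  ∷ - + 10 ∷ + 5   ∷ + 0 ∷ []
stirlingPoly _ = + 0 ∷ + 0   ∷ + 0   ∷ + 0    ∷ + 0   ∷ + 0 ∷ []

cyclePoly : ℕ → Vec ℤ 6
cyclePoly 2 = + 0 ∷ + 0   ∷ + 0   ∷ + 0    ∷ + 1    ∷ + 1   ∷ []
cyclePoly 3 = + 0 ∷ + 0   ∷ + 0   ∷ + 1    ∷ - + 3  ∷ - + 1 ∷ []
cyclePoly 4 = + 0 ∷ + 0   ∷ + 1   ∷ - + 4  ∷ + 6    ∷ + 1   ∷ []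
cyclePoly 5 = + 0 ∷ + 1   ∷ - + 5 ∷ + 10   ∷ - + 10 ∷ - + 1 ∷ []
cyclePoly 6 = + 1 ∷ - + 6 ∷ + 15  ∷ - + 20 ∷ + 15   ∷ + 1   ∷ []
cyclePoly _ = + 0 ∷ + 0   ∷ + 0   ∷ + 0    ∷ + 0    ∷ + 0   ∷ []

StirlingClosedForm : ℕ → Set
StirlingClosedForm j = ∀ n → + (j ! * stirling (suc n) j) ≡ eval basis (stirlingPoly j) (suc n)

CycleClosedForm : ℕ → Set
CycleClosedForm k = ∀ n → + (k ! * S (cycle (suc n)) k) ≡ eval basis (cyclePoly k) (suc n)

stirling-closed-form-suc : ∀ i → StirlingClosedForm i →
  shift basis (stirlingPoly (suc i)) ≡ + suc i ⊛ (stirlingPoly (suc i) ⊕ stirlingPoly i) →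
  + (suc i ! * stirling 1 (suc i)) ≡ eval basis (stirlingPoly (suc i)) 1 →
  StirlingClosedForm (suc i)
stirling-closed-form-suc i previous recurrence initial zero    = initial
stirling-closed-form-suc i previous recurrence initial (suc n) = begin
  + (suc i ! * stirling (suc (suc n)) (suc i))
    ≡⟨ cong +_ (distribute (suc i) (i !) (stirling (suc n) (suc i)) (stirling (suc n) i)) ⟩
  + (suc i * (suc i ! * stirling (suc n) (suc i) + i ! * stirling (suc n) i))
    ≡⟨ trans (ℤ.pos-* (suc i) _) (cong (+ suc i ℤ.*_) (ℤ.pos-+ (suc i ! * _) (i ! * _))) ⟩
  + suc i ℤ.* (+ (suc i ! * stirling (suc n) (suc i)) ℤ.+ + (i ! * stirling (suc n) i))
    ≡⟨ cong (+ suc i ℤ.*_) (cong₂ ℤ._+_ (stirling-closed-form-suc i previous recurrence initial n)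
                                        (previous n)) ⟩
  + suc i ℤ.* (eval basis (stirlingPoly (suc i)) (suc n) ℤ.+ eval basis (stirlingPoly i) (suc n))
    ≡⟨ trans (eval-⊛ (+ suc i) basis (stirlingPoly (suc i) ⊕ stirlingPoly i) (suc n))
             (cong (+ suc i ℤ.*_) (eval-⊕ basis (stirlingPoly (suc i)) (stirlingPoly i) (suc n))) ⟨
  eval basis (+ suc i ⊛ (stirlingPoly (suc i) ⊕ stirlingPoly i)) (suc n)
    ≡⟨ cong (λ cs → eval basis cs (suc n)) recurrence ⟨
  eval basis (shift basis (stirlingPoly (suc i))) (suc n)
    ≡⟨ eval-shift basis (stirlingPoly (suc i)) (suc n) ⟩
  eval basis (stirlingPoly (suc i)) (suc (suc n)) ∎
  where
  open ≡-Reasoning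
  distribute : ∀ j f s t → (j * f) * (j * s + t) ≡ j * ((j * f) * s + f * t)
  distribute = ℕ-Solver.solve-∀

stirling-closed-form : ∀ j {_ : True (j ≤? 5)} → StirlingClosedForm j
stirling-closed-form 0 n = refl
stirling-closed-form 1   = stirling-closed-form-suc 0 (stirling-closed-form 0) refl refl
stirling-closed-form 2   = stirling-closed-form-suc 1 (stirling-closed-form 1) refl refl
stirling-closed-form 3   = stirling-closed-form-suc 2 (stirling-closed-form 2) refl refl
stirling-closed-form 4   = stirling-closed-form-suc 3 (stirling-closed-form 3) refl refl
stirling-closed-form 5   = stirling-closed-form-suc 4 (stirling-closed-form 4) refl refl
stirling-closed-form (suc (suc (suc (suc (suc (suc _)))))) {()}

m+n≡o⇒m≡o-n : ∀ {m n o} → m + n ≡ o → + m ≡ + o ℤ.- + n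
m+n≡o⇒m≡o-n {m} {n} refl = trans (sym (cancel (+ m) (+ n))) (cong (ℤ._- + n) (sym (ℤ.pos-+ m n)))
  where
  cancel : ∀ x y → x ℤ.+ y ℤ.- y ≡ x
  cancel = ℤ-Solver.solve-∀

cycle-closed-form-suc : ∀ i → StirlingClosedForm i →
  shift basis (cyclePoly (suc i)) ≡ + suc i ⊛ stirlingPoly i ⊝ cyclePoly (suc i) →
  eval basis (cyclePoly (suc i)) 1 ≡ 0ℤ →
  CycleClosedForm (suc i)
cycle-closed-form-suc i stirling-i recurrence initial zero
  rewrite S-cycle-one (suc i) | *-zeroʳ (suc i !) = sym initial
cycle-closed-form-suc i stirling-i recurrence initial (suc n) = begin
  + (suc i ! * S (cycle (suc (suc n))) (suc i))
    ≡⟨ m+n≡o⇒m≡o-n scaled-recurrence ⟩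
  + (suc i * (i ! * stirling (suc n) i)) ℤ.- + (suc i ! * S (cycle (suc n)) (suc i))
    ≡⟨ cong₂ ℤ._-_ (trans (ℤ.pos-* (suc i) _) (cong (+ suc i ℤ.*_) (stirling-i n)))
                   (cycle-closed-form-suc i stirling-i recurrence initial n) ⟩
  + suc i ℤ.* eval basis (stirlingPoly i) (suc n) ℤ.- eval basis (cyclePoly (suc i)) (suc n)
    ≡⟨ trans (eval-⊝ basis (+ suc i ⊛ stirlingPoly i) (cyclePoly (suc i)) (suc n))
             (cong (ℤ._- eval basis (cyclePoly (suc i)) (suc n))
                   (eval-⊛ (+ suc i) basis (stirlingPoly i) (suc n))) ⟨
  eval basis (+ suc i ⊛ stirlingPoly i ⊝ cyclePoly (suc i)) (suc n)
    ≡⟨ cong (λ cs → eval basis cs (suc n)) recurrence ⟨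
  eval basis (shift basis (cyclePoly (suc i))) (suc n)
    ≡⟨ eval-shift basis (cyclePoly (suc i)) (suc n) ⟩
  eval basis (cyclePoly (suc i)) (suc (suc n)) ∎
  where
  open ≡-Reasoning
  scaled-recurrence : suc i ! * S (cycle (suc (suc n))) (suc i) + suc i ! * S (cycle (suc n)) (suc i)
                      ≡ suc i * (i ! * stirling (suc n) i)
  scaled-recurrence = trans (sym (*-distribˡ-+ (suc i !) _ _))
    (trans (cong (suc i ! *_) (S-cycle-stirling i n)) (*-assoc (suc i) (i !) _))

cycle-closed-form : ∀ k {_ : True (2 ≤? k)} {_ : True (k ≤? 6)} → CycleClosedForm k
cycle-closed-form 2 = cycle-closed-form-suc 1 (stirling-closed-form 1) refl refl
cycle-closed-form 3 = cycle-closed-form-suc 2 (stirling-closed-form 2) refl refl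
cycle-closed-form 4 = cycle-closed-form-suc 3 (stirling-closed-form 3) refl refl
cycle-closed-form 5 = cycle-closed-form-suc 4 (stirling-closed-form 4) refl refl
cycle-closed-form 6 = cycle-closed-form-suc 5 (stirling-closed-form 5) refl refl
cycle-closed-form 0 {()}
cycle-closed-form 1 {()}
cycle-closed-form (suc (suc (suc (suc (suc (suc (suc _))))))) {_} {()}

0<j-i⇒i<j : ∀ {i j} → 0ℤ ℤ.< j ℤ.- i → i ℤ.< j
0<j-i⇒i<j {i} {j} 0<j-i = subst₂ ℤ._<_ (ℤ.+-identityˡ i) (cancel j i) (ℤ.+-monoˡ-< i 0<j-i)
  where
  cancel : ∀ x y → x ℤ.- y ℤ.+ y ≡ x
  cancel = ℤ-Solver.solve-∀

<-from-closed-forms : ∀ c k s t {e} {u w : Vec ℤ 6} →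
  + (k ! * s) ≡ eval basis u e → + (suc k ! * t) ≡ eval basis w e →
  0ℤ ℤ.< eval basis (w ⊝ + (c * suc k) ⊛ u) e → c * s < t
<-from-closed-forms c k s t {e} {u} {w} s-closed t-closed positive =
  *-cancelˡ-< (suc k !) (c * s) t (ℤ.drop‿+<+ (begin-strict
    + (suc k ! * (c * s))               ≡⟨ cong +_ (rearrange c k (k !) s) ⟩
    + (c * suc k * (k ! * s))           ≡⟨ ℤ.pos-* (c * suc k) (k ! * s) ⟩
    + (c * suc k) ℤ.* + (k ! * s)       ≡⟨ cong (+ (c * suc k) ℤ.*_) s-closed ⟩
    + (c * suc k) ℤ.* eval basis u e    ≡⟨ eval-⊛ (+ (c * suc k)) basis u e ⟨
    eval basis (+ (c * suc k) ⊛ u) e    <⟨ 0<j-i⇒i<j (subst (0ℤ ℤ.<_) (eval-⊝ basis w _ e) positive) ⟩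
    eval basis w e                      ≡⟨ t-closed ⟨
    + (suc k ! * t)                     ∎))
  where
  open ℤ.≤-Reasoning
  rearrange : ∀ c k f s → (suc k * f) * (c * s) ≡ c * suc k * (f * s)
  rearrange = ℕ-Solver.solve-∀

cycle-ratio : ∀ c k {n} → CycleClosedForm k → CycleClosedForm (suc k) →
  ∀ M x {_ : T (eventually-dominated? basis
                  (cyclePoly (suc k) ⊝ + (c * suc k) ⊛ cyclePoly k) M x)} →
  M ≤ suc n → c * S (cycle (suc n)) k < S (cycle (suc n)) (suc k)
cycle-ratio c k {n} closed closed′ M x {ok} M≤n =
  <-from-closed-forms c k (S (cycle (suc n)) k) (S (cycle (suc n)) (suc k))
    {u = cyclePoly k} {w = cyclePoly (suc k)}
    (closed n) (closed′ n) (positive basis _ M x {ok} (suc n) M≤n)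

cycle-growth : ∀ c k {n} → CycleClosedForm k → CycleClosedForm (suc k) →
  ∀ M x {_ : T (eventually-dominated? basis
                  (shift basis (cyclePoly (suc k)) ⊝ + (c * suc k) ⊛ cyclePoly k) M x)} →
  M ≤ suc n → c * S (cycle (suc n)) k < S (cycle (suc (suc n))) (suc k)
cycle-growth c k {n} closed closed′ M x {ok} M≤n =
  <-from-closed-forms c k (S (cycle (suc n)) k) (S (cycle (suc (suc n))) (suc k))
    {u = cyclePoly k} {w = shift basis (cyclePoly (suc k))}
    (closed n) (trans (closed′ (suc n)) (sym (eval-shift basis (cyclePoly (suc k)) (suc n))))
    (positive basis _ M x {ok} (suc n) M≤n)

lemma9 : ∀ (n : ℕ) → 9 ≤ n →
    (S (cycle n) 2 < S (cycle n) 3 × S (cycle n) 3 < S (cycle n) 4 × S (cycle n) 4 < S (cycle n) 5)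
    × (3 * S (cycle (n ∸ 1)) 2 < S (cycle n) 3 × 3 * S (cycle (n ∸ 1)) 3 < S (cycle n) 4
       × 3 * S (cycle (n ∸ 1)) 4 < S (cycle n) 5 × 3 * S (cycle (n ∸ 1)) 5 < S (cycle n) 6)
    × 8 * S (cycle n) 3 < S (cycle n) 4
lemma9 (suc (suc m)) 9≤n@(s≤s 8≤n-1) =
    ( increasing (cycle-ratio 1 2 (cycle-closed-form 2) (cycle-closed-form 3) 9 0 9≤n)
    , increasing (cycle-ratio 1 3 (cycle-closed-form 3) (cycle-closed-form 4) 9 0 9≤n)
    , increasing (cycle-ratio 1 4 (cycle-closed-form 4) (cycle-closed-form 5) 9 0 9≤n) )
  , ( cycle-growth 3 2 (cycle-closed-form 2) (cycle-closed-form 3) 8 0 8≤n-1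
    , cycle-growth 3 3 (cycle-closed-form 3) (cycle-closed-form 4) 8 0 8≤n-1
    , cycle-growth 3 4 (cycle-closed-form 4) (cycle-closed-form 5) 8 0 8≤n-1
    -- the leading term 5ⁿ dominates only from n = 12 on; n = 9, 10, 11 are evaluated
    , cycle-growth 3 5 (cycle-closed-form 5) (cycle-closed-form 6) 8 3 8≤n-1 )
  , cycle-ratio 8 3 (cycle-closed-form 3) (cycle-closed-form 4) 9 0 9≤n
  where
  increasing : ∀ {a b} → 1 * a < b → a < b
  increasing = subst (_< _) (*-identityˡ _)
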